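{- Let $G$ be a Nim sequence with seed of length $L$ over a sequence $(\mathcal{Y}_x)_{x\in\mathbb{N}}$ of finite subsets of $\mathbb{Z}$ that is additively periodic with period length $p$, and let $R\in\mathbb{N}^+$. Then $G$ is additively periodic with a period length dividing $Rp$ if and only if there exists $x\ge L$ such that $S^*_{x+Rp}=S^*_x+Rp$ and $T^*_{x+Rp}=T^*_x+Rp$.
   Context: $\mathbb{N}=\{0,1,2,\dots\}$. For a finite $Y\subseteq\mathbb{Z}$, $\operatorname{mex}(Y)=\min(\mathbb{N}\setminus Y)$. $(\mathcal{Y}_x)$ is additively periodic with period length $p\ge1$ if $\mathcal{Y}_{x+p}=\mathcal{Y}_x+p$ for all $x\in\mathbb{N}$ ($p$ least such). A Nim sequence over $(\mathcal{Y}_x)$ with seed $[g_0,\dots,g_{L-1}]$ ($g_i\in\mathbb{N}$ pairwise distinct) is $G:\mathbb{N}\to\mathbb{N}$ with $G(x)=g_x$ for $x<L$ and $G(x)=\operatorname{mex}(\{G(x'):x'<x\}\cup\mathcal{Y}_x)$ for $x\ge L$. $G$ is additively periodic if there are $\tilde P$, $\tilde p\ge1$ with $G(x+\tilde p)=G(x)+\tilde p$ for all $x\ge\tilde P$; the least such $\tilde p$ is the period length. The cut after $x\in\mathbb{N}$: $S_x=\{x'\in\mathbb{N}:x'\le x,\ G(x')>x\}$, $T_x=\{x'\in\mathbb{N}:x'>x,\ G(x')\le x\}$, and $S^*_x=G(T_x)$, $T^*_x=G(S_x)$. -}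

module Defs where

open import Data.Nat using (ℕ; _+_; _*_; _≤_; _<_; _>_; _≥_)
open import Data.Nat.Divisibility using (_∣_)
open import Data.Integer as ℤ using (ℤ; +_)
open import Data.List using (List; length; lookup)
open import Data.List.Membership.Propositional using (_∈_)
open import Data.List.Relation.Unary.Unique.Propositional using (Unique)
open import Data.Fin using (fromℕ<)
open import Data.Product using (Σ; ∃; ∃-syntax; _×_)
open import Data.Sum using (_⊎_)
open import Relation.Nullary using (¬_)
open import Relation.Binary.PropositionalEquality using (_≡_)
open import Function.Bundles using (_⇔_)

-- Finite subsets of ℤ are represented by lists (membership = list membership).

IsPeriodOfY : (ℕ → List ℤ) → ℕ → Set
IsPeriodOfY Y p = ∀ x z → (z ∈ Y (x + p)) ⇔ (∃[ w ] (w ∈ Y x × z ≡ w ℤ.+ + p))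

YPeriodLength : (ℕ → List ℤ) → ℕ → Set
YPeriodLength Y p = 1 ≤ p × IsPeriodOfY Y p × (∀ q → 1 ≤ q → IsPeriodOfY Y q → p ≤ q)

IsMex : (ℤ → Set) → ℕ → Set
IsMex P m = ¬ P (+ m) × (∀ k → k < m → P (+ k))

IsNimSequence : (ℕ → List ℤ) → List ℕ → (ℕ → ℕ) → Set
IsNimSequence Y seed G =
  Unique seed ×
  (∀ x (h : x < length seed) → G x ≡ lookup seed (fromℕ< h)) ×
  (∀ x → x ≥ length seed →
     IsMex (λ z → (∃[ x' ] (x' < x × z ≡ + G x')) ⊎ z ∈ Y x) (G x))

IsPeriodOfG : (ℕ → ℕ) → ℕ → Set
IsPeriodOfG G q = ∃[ P ] (∀ x → x ≥ P → G (x + q) ≡ G x + q)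

GPeriodLength : (ℕ → ℕ) → ℕ → Set
GPeriodLength G q = 1 ≤ q × IsPeriodOfG G q × (∀ q' → 1 ≤ q' → IsPeriodOfG G q' → q ≤ q')

-- S*_x = G(T_x),  T_x = {x' > x : G x' ≤ x}
SStar : (ℕ → ℕ) → ℕ → ℕ → Set
SStar G x n = ∃[ x' ] (x' > x × G x' ≤ x × G x' ≡ n)

-- T*_x = G(S_x),  S_x = {x' ≤ x : G x' > x}
TStar : (ℕ → ℕ) → ℕ → ℕ → Set
TStar G x n = ∃[ x' ] (x' ≤ x × G x' > x × G x' ≡ n)

ShiftEq : (ℕ → Set) → (ℕ → Set) → ℕ → Set
ShiftEq A B k = ∀ n → A n ⇔ (∃[ m ] (B m × n ≡ m + k))

{-# OPTIONS --safe #-}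
-- If G(x + N) = G(x) + N from some point P on, then for x beyond P and beyond every value
-- taken before P + N, both cut sets simply shift by N.
--
-- Conversely, G is a bijection of ℕ: injective by the mex rule and the distinct seed, and
-- surjective because a periodic sequence of finite sets eventually avoids any given value.
-- So the values taken at positions ≤ x are {u ≤ x | u ∉ S*ₓ} ∪ T*ₓ, and the cut conditions at
-- x₀ say that the values taken before x₀ + 1 + N are [0, N) ∪ (values taken before x₀ + 1) + N.
-- This invariant propagates: with 𝒴_{y+N} = 𝒴_y + N it makes the set excluded at y + N the
-- same padded shift of the set excluded at y, so G(y + N) = G(y) + N, which extends the
-- invariant to y + 1. Finally, eventual periodicity with period N is checkable on one window
-- of length N, so a least period q exists, and q ∣ N since N mod q is again a period.

module Submission where

open import Defs
open import Data.Nat using (ℕ; _+_; _*_; _≤_; _≥_)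
open import Data.Nat.Divisibility using (_∣_)
open import Data.Integer using (ℤ)
open import Data.List using (List; length)
open import Data.Product using (∃-syntax; _×_)
open import Function.Bundles using (_⇔_)

open import Level using (Level; 0ℓ)
open import Data.Nat
  using (zero; suc; s≤s; _∸_; _<_; _⊔_; _≟_; _<?_; _≤?_; NonZero; >-nonZero; _≤′_; ≤′-refl; ≤′-step)
open import Data.Nat.Properties
open import Data.Nat.Divisibility using (divides; m%n≡0⇒n∣m)
open import Data.Nat.DivMod using (_%_; _/_; m≡m%n+[m/n]*n; m%n<n)
open import Data.Nat.Induction using (<-rec)
open import Algebra.Properties.CommutativeSemigroup +-commutativeSemigroup
  using (xy∙z≈xz∙y; x∙yz≈xz∙y)
import Data.Integer as ℤ
open import Data.Integer using (+_; -[1+_]; ∣_∣)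
import Data.Integer.Properties as ℤ
open import Algebra.Properties.AbelianGroup ℤ.+-0-abelianGroup using (xyx⁻¹≈y)
open import Data.List using ([]; _∷_; lookup)
open import Data.List.Membership.Propositional using (_∈_; _∉_)
open import Data.List.Membership.Propositional.Properties using (∈-lookup)
open import Data.List.Relation.Unary.Any using (here; there)
import Data.List.Relation.Unary.All as All
open import Data.List.Relation.Unary.AllPairs using (_∷_)
open import Data.List.Relation.Unary.Unique.Propositional using (Unique)
open import Data.Fin using (Fin; toℕ; fromℕ<)
import Data.Fin as Fin
open import Data.Fin.Properties using (toℕ-fromℕ<)
open import Data.Product using (_,_; proj₁; proj₂)
import Data.Product as Product
open import Data.Sum using (_⊎_; inj₁; inj₂)
import Data.Sum as Sum
open import Data.Empty using (⊥-elim)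
open import Function.Base using (_∘_; _⟨_⟩_)
open import Function.Bundles using (mk⇔; Equivalence)
open import Function.Definitions using (Injective)
open import Relation.Binary.Definitions using (tri<; tri≈; tri>)
open import Relation.Binary.PropositionalEquality
open import Relation.Nullary using (¬_; yes; no)
open import Relation.Nullary.Decidable using (map′; _×-dec_)
open import Relation.Unary using (Pred; _⊆_; _∪_; _≐_; ｛_｝)
import Relation.Unary as U

variable
  ℓ : Level
  A A' B B' : Pred ℕ 0ℓ
  a b m m' n N P q : ℕ
  Y : ℕ → List ℤ

-- Shifts of sets of naturals

Shifted : Pred ℕ 0ℓ → ℕ → Pred ℕ 0ℓ
Shifted B N n = ∃[ m ] (B m × n ≡ m + N)

Below : ℕ → Pred ℕ 0ℓ
Below N = _< N

ShiftAbove : Pred ℕ 0ℓ → Pred ℕ 0ℓ → ℕ → Set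
ShiftAbove A B N = (A ⊆ Below N ∪ Shifted B N) × (Shifted B N ⊆ A)

PaddedShift : Pred ℕ 0ℓ → Pred ℕ 0ℓ → ℕ → Set
PaddedShift A B N = ShiftAbove A B N × (Below N ⊆ A)

<⊎∸+≡ : ∀ n N → n < N ⊎ n ∸ N + N ≡ n
<⊎∸+≡ n N with n <? N
... | yes n<N = inj₁ n<N
... | no n≮N = inj₂ (m∸n+n≡m (≮⇒≥ n≮N))

shifted-mono : A ⊆ B → Shifted A N ⊆ Shifted B N
shifted-mono A⊆B (m , a , e) = m , A⊆B a , e

shifted-≥ : Shifted A N n → N ≤ n
shifted-≥ {N = N} (m , _ , refl) = m≤n+m N m

shifted-cancel : Shifted A N (n + N) → A n
shifted-cancel {A} {N} {n} (m , a , e) = subst A (sym (+-cancelʳ-≡ N n m e)) a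

shiftAbove-∪ : ShiftAbove A B N → ShiftAbove A' B' N → ShiftAbove (A ∪ A') (B ∪ B') N
shiftAbove-∪ {A} {B} {N} {A'} {B'} (A⊆ , ⊆A) (A'⊆ , ⊆A') = lower , upper
  where
  lower : A ∪ A' ⊆ Below N ∪ Shifted (B ∪ B') N
  lower (inj₁ a) = Sum.map₂ (shifted-mono inj₁) (A⊆ a)
  lower (inj₂ a') = Sum.map₂ (shifted-mono inj₂) (A'⊆ a')
  upper : Shifted (B ∪ B') N ⊆ A ∪ A'
  upper (m , inj₁ b , e) = inj₁ (⊆A (m , b , e))
  upper (m , inj₂ b' , e) = inj₂ (⊆A' (m , b' , e))

shiftAbove-｛｝ : ShiftAbove ｛ a + N ｝ ｛ a ｝ N
shiftAbove-｛｝ {a} = (λ { refl → inj₂ (a , refl , refl) }) , λ { (_ , refl , refl) → refl }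

paddedShift-∪ : PaddedShift A B N → ShiftAbove A' B' N → PaddedShift (A ∪ A') (B ∪ B') N
paddedShift-∪ (shift , below) shift' = shiftAbove-∪ shift shift' , inj₁ ∘ below

paddedShift-≐ : A ≐ A' → B ≐ B' → PaddedShift A B N → PaddedShift A' B' N
paddedShift-≐ (A⊆A' , A'⊆A) (B⊆B' , B'⊆B) ((A⊆ , ⊆A) , below) =
  ((Sum.map₂ (shifted-mono B⊆B') ∘ A⊆ ∘ A'⊆A) , (A⊆A' ∘ ⊆A ∘ shifted-mono B'⊆B)) , A⊆A' ∘ below

CutValues : ℕ → Pred ℕ 0ℓ → Pred ℕ 0ℓ → Pred ℕ 0ℓ
CutValues x S T = (λ u → u ≤ x × ¬ S u) ∪ T

paddedShift-cut : ∀ {S S' T T' : Pred ℕ 0ℓ} x N → ShiftEq S' S N → ShiftEq T' T N →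
                  PaddedShift (CutValues (x + N) S' T') (CutValues x S T) N
paddedShift-cut {S} {S'} {T} {T'} x N S'≐ T'≐ = (lower , upper) , below
  where
  below : Below N ⊆ CutValues (x + N) S' T'
  below u<N = inj₁ (≤-trans (<⇒≤ u<N) (m≤n+m N x) ,
                    λ s' → <⇒≱ u<N (shifted-≥ (Equivalence.to (S'≐ _) s')))
  upper : Shifted (CutValues x S T) N ⊆ CutValues (x + N) S' T'
  upper (v , inj₁ (v≤x , v∉S) , refl) =
    inj₁ (+-monoˡ-≤ N v≤x , v∉S ∘ shifted-cancel ∘ Equivalence.to (S'≐ _))
  upper (v , inj₂ t , refl) = inj₂ (Equivalence.from (T'≐ _) (v , t , refl))
  lower : CutValues (x + N) S' T' ⊆ Below N ∪ Shifted (CutValues x S T) N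
  lower {u} (inj₁ (u≤x+N , u∉S')) with <⊎∸+≡ u N
  ... | inj₁ u<N = inj₁ u<N
  ... | inj₂ e = inj₂ (u ∸ N , inj₁ (v≤x , v∉S) , sym e)
    where
    v≤x : u ∸ N ≤ x
    v≤x = subst (u ∸ N ≤_) (m+n∸n≡m x N) (∸-monoˡ-≤ N u≤x+N)
    v∉S : ¬ S (u ∸ N)
    v∉S s = u∉S' (subst S' e (Equivalence.from (S'≐ _) (u ∸ N , s , refl)))
  lower (inj₂ t') = inj₂ (shifted-mono inj₂ (Equivalence.to (T'≐ _) t'))

mex-≤ : ∀ {X : ℤ → Set} → IsMex X m → ¬ X (+ n) → m ≤ n
mex-≤ (_ , below) n∉X = ≮⇒≥ (n∉X ∘ below _)

≤-mex : ∀ {X : ℤ → Set} → IsMex X m → (∀ k → k < n → X (+ k)) → n ≤ m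
≤-mex (m∉X , _) all = ≮⇒≥ (m∉X ∘ all _)

mex-shift : ∀ {X X' : ℤ → Set} → IsMex X m → IsMex X' m' →
            PaddedShift (X' ∘ +_) (X ∘ +_) N → m' ≡ m + N
mex-shift {m} {N = N} {X} {X'} mexX mexX' ((X'⊆ , ⊆X') , below) =
  ≤-antisym (mex-≤ {X = X'} mexX' m+N∉X') (≤-mex {X = X'} mexX' below-m+N)
  where
  m+N∉X' : ¬ X' (+ (m + N))
  m+N∉X' x' with X'⊆ x'
  ... | inj₁ m+N<N = <⇒≱ m+N<N (m≤n+m N m)
  ... | inj₂ s = proj₁ mexX (shifted-cancel s)
  below-m+N : ∀ k → k < m + N → X' (+ k)
  below-m+N k k<m+N with <⊎∸+≡ k N
  ... | inj₁ k<N = below k<N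
  ... | inj₂ e = subst (X' ∘ +_) e (⊆X' (k ∸ N , proj₂ mexX (k ∸ N) k∸N<m , refl))
    where
    k∸N<m : k ∸ N < m
    k∸N<m = +-cancelʳ-< N (k ∸ N) m (subst (_< m + N) (sym e) k<m+N)

-- Periodic sequences of finite sets of integers

+u≡w+N⇒u<N⊎w≥0 : ∀ u N w → + u ≡ w ℤ.+ + N → u < N ⊎ ∃[ v ] (w ≡ + v × u ≡ v + N)
+u≡w+N⇒u<N⊎w≥0 u N (+ v) e = inj₂ (v , refl , ℤ.+-injective e)
+u≡w+N⇒u<N⊎w≥0 u N -[1+ n ] e =
  inj₁ (ℤ.drop‿+<+ (subst (ℤ._< + N) (sym e) (ℤ.+-monoˡ-< (+ N) ℤ.-<+)))

+v≡w+b⇒b≤v+∣w∣ : ∀ v b w → + v ≡ w ℤ.+ + b → b ≤ v + ∣ w ∣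
+v≡w+b⇒b≤v+∣w∣ v b w e = begin
  ∣ + b ∣                  ≡⟨ cong ∣_∣ (xyx⁻¹≈y w (+ b)) ⟨
  ∣ w ℤ.+ + b ℤ.- w ∣      ≡⟨ cong (λ z → ∣ z ℤ.- w ∣) e ⟨
  ∣ + v ℤ.- w ∣            ≤⟨ ℤ.∣i-j∣≤∣i∣+∣j∣ (+ v) w ⟩
  v + ∣ w ∣                ∎
  where open ≤-Reasoning

abs-bounded : (l : List ℤ) → ∃[ c ] (∀ {w} → w ∈ l → ∣ w ∣ ≤ c)
abs-bounded [] = 0 , λ ()
abs-bounded (w ∷ l) with abs-bounded l
... | c , bounded = ∣ w ∣ ⊔ c , λ { (here refl) → m≤m⊔n ∣ w ∣ c
                                   ; (there w∈l) → ≤-trans (bounded w∈l) (m≤n⊔m ∣ w ∣ c) }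

isPeriodOfY-0 : IsPeriodOfY Y 0
isPeriodOfY-0 {Y} x z = mk⇔
  (λ z∈ → z , subst (λ y → z ∈ Y y) (+-identityʳ x) z∈ , sym (ℤ.+-identityʳ z))
  (λ { (w , w∈ , refl) → subst₂ (λ c y → c ∈ Y y) (sym (ℤ.+-identityʳ w)) (sym (+-identityʳ x)) w∈ })

isPeriodOfY-+ : IsPeriodOfY Y a → IsPeriodOfY Y b → IsPeriodOfY Y (a + b)
isPeriodOfY-+ {Y} {a} {b} per-a per-b x z = mk⇔ to from
  where
  x+[a+b]≡x+b+a : x + (a + b) ≡ x + b + a
  x+[a+b]≡x+b+a = x∙yz≈xz∙y x a b
  w+b+a≡w+[a+b] : ∀ w → w ℤ.+ + b ℤ.+ + a ≡ w ℤ.+ + (a + b)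
  w+b+a≡w+[a+b] w = ℤ.+-assoc w (+ b) (+ a) ⟨ trans ⟩ cong (λ c → w ℤ.+ + c) (+-comm b a)
  to : ∀ {z} → z ∈ Y (x + (a + b)) → ∃[ w ] (w ∈ Y x × z ≡ w ℤ.+ + (a + b))
  to {z} z∈ with Equivalence.to (per-a (x + b) z) (subst (λ y → z ∈ Y y) x+[a+b]≡x+b+a z∈)
  ... | w' , w'∈ , refl with Equivalence.to (per-b x w') w'∈
  ...   | w , w∈ , refl = w , w∈ , w+b+a≡w+[a+b] w
  from : ∀ {z} → ∃[ w ] (w ∈ Y x × z ≡ w ℤ.+ + (a + b)) → z ∈ Y (x + (a + b))
  from (w , w∈ , refl) =
    subst₂ (λ c y → c ∈ Y y) (w+b+a≡w+[a+b] w) (sym x+[a+b]≡x+b+a)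
      (Equivalence.from (per-a (x + b) _) (_ , Equivalence.from (per-b x _) (w , w∈ , refl) , refl))

isPeriodOfY-* : IsPeriodOfY Y a → ∀ k → IsPeriodOfY Y (k * a)
isPeriodOfY-* per zero = isPeriodOfY-0
isPeriodOfY-* per (suc k) = isPeriodOfY-+ per (isPeriodOfY-* per k)

ℕ∈ : List ℤ → Pred ℕ 0ℓ
ℕ∈ l u = + u ∈ l

shiftAbove-ℕ∈ : IsPeriodOfY Y N → ∀ y → ShiftAbove (ℕ∈ (Y (y + N))) (ℕ∈ (Y y)) N
shiftAbove-ℕ∈ {Y} {N} per y = lower , upper
  where
  lower : ℕ∈ (Y (y + N)) ⊆ Below N ∪ Shifted (ℕ∈ (Y y)) N
  lower {u} u∈ with Equivalence.to (per y (+ u)) u∈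
  ... | w , w∈ , e with +u≡w+N⇒u<N⊎w≥0 u N w e
  ...   | inj₁ u<N = inj₁ u<N
  ...   | inj₂ (v , refl , u≡v+N) = inj₂ (v , w∈ , u≡v+N)
  upper : Shifted (ℕ∈ (Y y)) N ⊆ ℕ∈ (Y (y + N))
  upper (v , v∈ , refl) = Equivalence.from (per y (+ (v + N))) (+ v , v∈ , refl)

eventually-∉ : 1 ≤ a → IsPeriodOfY Y a → ∀ x v → ∃[ y ] (x ≤ y × + v ∉ Y y)
eventually-∉ {a} {Y} 1≤a per x v = x + K * a , m≤m+n x (K * a) , avoid
  where
  c = proj₁ (abs-bounded (Y x))
  K = suc (v + c)
  avoid : + v ∉ Y (x + K * a)
  avoid v∈ with Equivalence.to (isPeriodOfY-* per K x (+ v)) v∈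
  ... | w , w∈ , e = <⇒≱ (n<1+n (v + c)) (begin
    K                ≤⟨ m≤m*n K a ⟩
    K * a            ≤⟨ +v≡w+b⇒b≤v+∣w∣ v (K * a) w e ⟩
    v + ∣ w ∣        ≤⟨ +-monoʳ-≤ v (proj₂ (abs-bounded (Y x)) w∈) ⟩
    v + c            ∎)
    where
    open ≤-Reasoning
    instance
      a≢0 : NonZero a
      a≢0 = >-nonZero 1≤a

-- Eventual additive periods

module _ (G : ℕ → ℕ) where

  PeriodFrom : ℕ → ℕ → Set
  PeriodFrom P q = ∀ x → x ≥ P → G (x + q) ≡ G x + q

  periodFrom-0 : PeriodFrom P 0
  periodFrom-0 x _ = cong G (+-identityʳ x) ⟨ trans ⟩ sym (+-identityʳ (G x))

  periodFrom-+ : PeriodFrom P a → PeriodFrom P b → PeriodFrom P (a + b)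
  periodFrom-+ {P} {a} {b} per-a per-b x x≥P = begin
    G (x + (a + b))  ≡⟨ cong G (+-assoc x a b) ⟨
    G (x + a + b)    ≡⟨ per-b (x + a) (≤-trans x≥P (m≤m+n x a)) ⟩
    G (x + a) + b    ≡⟨ cong (_+ b) (per-a x x≥P) ⟩
    G x + a + b      ≡⟨ +-assoc (G x) a b ⟩
    G x + (a + b)    ∎
    where open ≡-Reasoning

  periodFrom-* : PeriodFrom P a → ∀ k → PeriodFrom P (k * a)
  periodFrom-* per zero = periodFrom-0
  periodFrom-* per (suc k) = periodFrom-+ per (periodFrom-* per k)

  periodFrom-cancelʳ : PeriodFrom P (a + b) → PeriodFrom P b → PeriodFrom P a
  periodFrom-cancelʳ {P} {a} {b} per-a+b per-b x x≥P = +-cancelʳ-≡ b _ _ (begin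
    G (x + a) + b    ≡⟨ per-b (x + a) (≤-trans x≥P (m≤m+n x a)) ⟨
    G (x + a + b)    ≡⟨ cong G (+-assoc x a b) ⟩
    G (x + (a + b))  ≡⟨ per-a+b x x≥P ⟩
    G x + (a + b)    ≡⟨ +-assoc (G x) a b ⟨
    G x + a + b      ∎)
    where open ≡-Reasoning

  -- Going N·P' steps to the right lands past P', where q is a period.
  periodFrom-transfer : 1 ≤ N → PeriodFrom P N → ∀ {P'} → PeriodFrom P' q → PeriodFrom P q
  periodFrom-transfer {N} {P} {q} 1≤N per-N {P'} per-q x x≥P = +-cancelʳ-≡ (P' * N) _ _ (begin
    G (x + q) + P' * N    ≡⟨ per-P'N (x + q) (≤-trans x≥P (m≤m+n x q)) ⟨
    G (x + q + P' * N)    ≡⟨ cong G (xy∙z≈xz∙y x q (P' * N)) ⟩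
    G (x + P' * N + q)    ≡⟨ per-q (x + P' * N) P'≤x+P'N ⟩
    G (x + P' * N) + q    ≡⟨ cong (_+ q) (per-P'N x x≥P) ⟩
    G x + P' * N + q      ≡⟨ xy∙z≈xz∙y (G x) (P' * N) q ⟩
    G x + q + P' * N      ∎)
    where
    open ≡-Reasoning
    per-P'N : PeriodFrom P (P' * N)
    per-P'N = periodFrom-* per-N P'
    P'≤x+P'N : P' ≤ x + P' * N
    P'≤x+P'N = ≤-trans (subst (_≤ P' * N) (*-identityʳ P') (*-monoʳ-≤ P' 1≤N)) (m≤n+m (P' * N) x)

  periodFrom-window : 1 ≤ N → PeriodFrom P N →
                      (∀ {i} → i < N → G (P + i + q) ≡ G (P + i) + q) → PeriodFrom P q
  periodFrom-window {N} {P} {q} 1≤N per-N window = <-rec Holds holds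
    where
    open ≡-Reasoning
    Holds : ℕ → Set
    Holds x = x ≥ P → G (x + q) ≡ G x + q
    shift : ∀ {y} → y ≥ P → G (y + q) ≡ G y + q → G (y + N + q) ≡ G (y + N) + q
    shift {y} y≥P eq = begin
      G (y + N + q)   ≡⟨ cong G (xy∙z≈xz∙y y N q) ⟩
      G (y + q + N)   ≡⟨ per-N (y + q) (≤-trans y≥P (m≤m+n y q)) ⟩
      G (y + q) + N   ≡⟨ cong (_+ N) eq ⟩
      G y + q + N     ≡⟨ xy∙z≈xz∙y (G y) q N ⟩
      G y + N + q     ≡⟨ cong (_+ q) (per-N y y≥P) ⟨
      G (y + N) + q   ∎
    holds : ∀ x → (∀ {y} → y < x → Holds y) → Holds x
    holds x rec x≥P with x <? P + N
    ... | yes x<P+N = subst (λ t → G (t + q) ≡ G t + q) (m+[n∸m]≡n x≥P)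
                        (window (+-cancelˡ-< P (x ∸ P) N (subst (_< P + N) (sym (m+[n∸m]≡n x≥P)) x<P+N)))
    ... | no x≮P+N = subst (λ t → G (t + q) ≡ G t + q) e (shift x∸N≥P (rec x∸N<x x∸N≥P))
      where
      e : x ∸ N + N ≡ x
      e = m∸n+n≡m (≤-trans (m≤n+m N P) (≮⇒≥ x≮P+N))
      x∸N≥P : x ∸ N ≥ P
      x∸N≥P = +-cancelʳ-≤ N P (x ∸ N) (subst (P + N ≤_) (sym e) (≮⇒≥ x≮P+N))
      x∸N<x : x ∸ N < x
      x∸N<x = subst (x ∸ N <_) e (m<m+n (x ∸ N) 1≤N)

  periodFrom? : 1 ≤ N → PeriodFrom P N → U.Decidable (PeriodFrom P)
  periodFrom? {N} {P} 1≤N per-N q =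
    map′ (periodFrom-window 1≤N per-N) (λ per {i} _ → per (P + i) (m≤m+n P i))
         (allUpTo? (λ i → G (P + i + q) ≟ G (P + i) + q) N)

minimal-witness : ∀ {Q : Pred ℕ ℓ} → U.Decidable Q → ∀ {n} → Q n →
                  ∃[ m ] (Q m × (∀ {k} → k < m → ¬ Q k))
minimal-witness {Q = Q} Q? {n} = <-rec _ search n
  where
  search : ∀ n → (∀ {m} → m < n → Q m → ∃[ m ] (Q m × (∀ {k} → k < m → ¬ Q k))) →
           Q n → ∃[ m ] (Q m × (∀ {k} → k < m → ¬ Q k))
  search n rec qn with anyUpTo? Q? n
  ... | yes (m , m<n , qm) = rec m<n qm
  ... | no none = n , qn , λ k<n qk → none (_ , k<n , qk)

-- N mod q is again an eventual period, and it is smaller than the least one q.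
leastPeriod : (G : ℕ → ℕ) → 1 ≤ N → PeriodFrom G P N → ∃[ q ] (GPeriodLength G q × q ∣ N)
leastPeriod {N} {P} G 1≤N per-N
  with minimal-witness (λ q → (1 ≤? q) ×-dec periodFrom? G 1≤N per-N q) (1≤N , per-N)
... | q , (1≤q , per-q) , smaller = q , (1≤q , (P , per-q) , least) , m%n≡0⇒n∣m N q N%q≡0
  where
  instance
    q≢0 : NonZero q
    q≢0 = >-nonZero 1≤q
  least : ∀ q' → 1 ≤ q' → IsPeriodOfG G q' → q ≤ q'
  least q' 1≤q' (P' , per-q') = ≮⇒≥ (λ q'<q → smaller q'<q (1≤q' , periodFrom-transfer G 1≤N per-N per-q'))
  per-N%q : PeriodFrom G P (N % q)
  per-N%q = periodFrom-cancelʳ G (subst (PeriodFrom G P) (m≡m%n+[m/n]*n N q) per-N)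
                                 (periodFrom-* G per-q (N / q))
  N%q≡0 : N % q ≡ 0
  N%q≡0 = n<1⇒n≡0 (≰⇒> λ 1≤N%q → smaller (m%n<n N q) (1≤N%q , per-N%q))

-- Cuts

CutsRepeat : (ℕ → ℕ) → ℕ → ℕ → Set
CutsRepeat G x N = ShiftEq (SStar G (x + N)) (SStar G x) N × ShiftEq (TStar G (x + N)) (TStar G x) N

module _ (G : ℕ → ℕ) {P N x : ℕ} (per-N : PeriodFrom G P N) (P≤x : P ≤ x) where

  private
    unshift : ∀ {y} → N ≤ y → ∃[ y' ] (y ≡ y' + N)
    unshift {y} N≤y = y ∸ N , sym (m∸n+n≡m N≤y)

  shiftEq-SStar : ShiftEq (SStar G (x + N)) (SStar G x) N
  shiftEq-SStar n = mk⇔ to from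
    where
    to : SStar G (x + N) n → Shifted (SStar G x) N n
    to (y , x+N<y , Gy≤x+N , refl) with unshift (≤-trans (m≤n+m N x) (<⇒≤ x+N<y))
    ... | y' , refl = G y' , (y' , x<y' , Gy'≤x , refl) , per-N y' (≤-trans P≤x (<⇒≤ x<y'))
      where
      x<y' : x < y'
      x<y' = +-cancelʳ-< N x y' x+N<y
      Gy'≤x : G y' ≤ x
      Gy'≤x = +-cancelʳ-≤ N (G y') x (subst (_≤ x + N) (per-N y' (≤-trans P≤x (<⇒≤ x<y'))) Gy≤x+N)
    from : Shifted (SStar G x) N n → SStar G (x + N) n
    from (_ , (y , x<y , Gy≤x , refl) , refl) =
      y + N , +-monoˡ-< N x<y , subst (_≤ x + N) (sym Gy+N) (+-monoˡ-≤ N Gy≤x) , Gy+N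
      where
      Gy+N : G (y + N) ≡ G y + N
      Gy+N = per-N y (≤-trans P≤x (<⇒≤ x<y))

  shiftEq-TStar : (∀ {y} → y < P + N → G y ≤ x) → ShiftEq (TStar G (x + N)) (TStar G x) N
  shiftEq-TStar G≤x n = mk⇔ to from
    where
    to : TStar G (x + N) n → Shifted (TStar G x) N n
    to (y , y≤x+N , x+N<Gy , refl) with y <? P + N
    ... | yes y<P+N = ⊥-elim (<⇒≱ x+N<Gy (≤-trans (G≤x y<P+N) (m≤m+n x N)))
    ... | no y≮P+N with unshift (≤-trans (m≤n+m N P) (≮⇒≥ y≮P+N))
    ...   | y' , refl = G y' , (y' , +-cancelʳ-≤ N y' x y≤x+N , x<Gy' , refl) , Gy'+N
      where
      Gy'+N : G (y' + N) ≡ G y' + N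
      Gy'+N = per-N y' (+-cancelʳ-≤ N P y' (≮⇒≥ y≮P+N))
      x<Gy' : x < G y'
      x<Gy' = +-cancelʳ-< N x (G y') (subst (x + N <_) Gy'+N x+N<Gy)
    from : Shifted (TStar G x) N n → TStar G (x + N) n
    from (_ , (y , y≤x , x<Gy , refl) , refl) with y <? P
    ... | yes y<P = ⊥-elim (<⇒≱ x<Gy (G≤x (≤-trans y<P (m≤m+n P N))))
    ... | no y≮P = y + N , +-monoˡ-≤ N y≤x ,
                   subst (x + N <_) (sym Gy+N) (+-monoˡ-< N x<Gy) , Gy+N
      where
      Gy+N : G (y + N) ≡ G y + N
      Gy+N = per-N y (≮⇒≥ y≮P)

prefix-bounded : (f : ℕ → ℕ) → ∀ n → ∃[ M ] (∀ {x} → x < n → f x ≤ M)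
prefix-bounded f zero = 0 , λ ()
prefix-bounded f (suc n) with prefix-bounded f n
... | M , bounded = f n ⊔ M , bound
  where
  bound : ∀ {x} → x < suc n → f x ≤ f n ⊔ M
  bound x<1+n with m<1+n⇒m<n∨m≡n x<1+n
  ... | inj₁ x<n = ≤-trans (bounded x<n) (m≤n⊔m (f n) M)
  ... | inj₂ refl = m≤m⊔n (f n) M

-- Past P and past every value taken before P + N, the cuts of G repeat with shift N.
cutsRepeat-eventually : (G : ℕ → ℕ) → PeriodFrom G P N → ∀ L → ∃[ x ] (x ≥ L × CutsRepeat G x N)
cutsRepeat-eventually {P} {N} G per-N L =
  x , ≤-trans (m≤m+n L P) (m≤m+n (L + P) M) ,
  shiftEq-SStar G per-N P≤x , shiftEq-TStar G per-N P≤x (λ y<P+N → ≤-trans (G≤M y<P+N) (m≤n+m M (L + P)))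
  where
  M = proj₁ (prefix-bounded G (P + N))
  G≤M = proj₂ (prefix-bounded G (P + N))
  x = L + P + M
  P≤x : P ≤ x
  P≤x = ≤-trans (m≤n+m P L) (m≤m+n (L + P) M)

Values : (ℕ → ℕ) → ℕ → Pred ℕ 0ℓ
Values G y u = ∃[ x' ] (x' < y × G x' ≡ u)

values-suc : ∀ (G : ℕ → ℕ) y → Values G y ∪ ｛ G y ｝ ≐ Values G (suc y)
values-suc G y = to , from
  where
  to : Values G y ∪ ｛ G y ｝ ⊆ Values G (suc y)
  to (inj₁ (x' , x'<y , e)) = x' , m<n⇒m<1+n x'<y , e
  to (inj₂ e) = y , n<1+n y , e
  from : Values G (suc y) ⊆ Values G y ∪ ｛ G y ｝
  from (x' , x'<1+y , e) with m<1+n⇒m<n∨m≡n x'<1+y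
  ... | inj₁ x'<y = inj₁ (x' , x'<y , e)
  ... | inj₂ refl = inj₂ e

-- For a bijection, a value u ≤ x is taken at or before x exactly when it is not taken after x.
cut≐values : ∀ {G : ℕ → ℕ} → Injective _≡_ _≡_ G → (∀ v → ∃[ z ] (G z ≡ v)) →
             ∀ x → CutValues x (SStar G x) (TStar G x) ≐ Values G (suc x)
cut≐values {G} G-inj G-surj x = to , from
  where
  to : CutValues x (SStar G x) (TStar G x) ⊆ Values G (suc x)
  to {u} (inj₁ (u≤x , u∉S*)) with G-surj u
  ... | z , refl with z ≤? x
  ...   | yes z≤x = z , s≤s z≤x , refl
  ...   | no z≰x = ⊥-elim (u∉S* (z , ≰⇒> z≰x , u≤x , refl))
  to (inj₂ (x' , x'≤x , _ , e)) = x' , s≤s x'≤x , e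
  from : Values G (suc x) ⊆ CutValues x (SStar G x) (TStar G x)
  from (x' , s≤s x'≤x , refl) with G x' ≤? x
  ... | yes Gx'≤x = inj₁ (Gx'≤x , λ { (x'' , x<x'' , _ , e) → <⇒≱ x<x'' (subst (_≤ x) (sym (G-inj e)) x'≤x) })
  ... | no Gx'≰x = inj₂ (x' , x'≤x , ≰⇒> Gx'≰x , refl)

-- Nim sequences

lookup-injective : ∀ {l : List ℕ} → Unique l → {i j : Fin (length l)} → lookup l i ≡ lookup l j → i ≡ j
lookup-injective (_ ∷ _) {Fin.zero} {Fin.zero} _ = refl
lookup-injective (x∉ ∷ _) {Fin.zero} {Fin.suc j} e = ⊥-elim (All.lookup x∉ (∈-lookup j) e)
lookup-injective (x∉ ∷ _) {Fin.suc i} {Fin.zero} e = ⊥-elim (All.lookup x∉ (∈-lookup i) (sym e))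
lookup-injective (_ ∷ unique) {Fin.suc i} {Fin.suc j} e = cong Fin.suc (lookup-injective unique e)

module NimSequence {Y : ℕ → List ℤ} {p : ℕ} (1≤p : 1 ≤ p) (perY : IsPeriodOfY Y p)
                   {seed : List ℕ} {G : ℕ → ℕ} (nim : IsNimSequence Y seed G) where

  L = length seed

  Excluded : ℕ → ℤ → Set
  Excluded y z = (∃[ x' ] (x' < y × z ≡ + G x')) ⊎ z ∈ Y y

  mex-G : ∀ {y} → L ≤ y → IsMex (Excluded y) (G y)
  mex-G = proj₂ (proj₂ nim) _

  excluded≐ : ∀ y → Values G y ∪ ℕ∈ (Y y) ≐ Excluded y ∘ +_
  excluded≐ y = Sum.map₁ (λ { (x' , x'<y , e) → x' , x'<y , cong +_ (sym e) }) ,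
                Sum.map₁ (λ { (x' , x'<y , e) → x' , x'<y , sym (ℤ.+-injective e) })

  G-distinct : ∀ {x x'} → x < x' → G x ≢ G x'
  G-distinct {x} {x'} x<x' e with L ≤? x'
  ... | yes L≤x' = proj₁ (mex-G L≤x') (inj₁ (x , x<x' , cong +_ (sym e)))
  ... | no L≰x' = <-irrefl x≡x' x<x'
    where
    open ≡-Reasoning
    x'<L = ≰⇒> L≰x'
    x<L = <-trans x<x' x'<L
    seed-at = proj₁ (proj₂ nim)
    x≡x' : x ≡ x'
    x≡x' = begin
      x                          ≡⟨ toℕ-fromℕ< x<L ⟨
      toℕ (fromℕ< x<L)           ≡⟨ cong toℕ (lookup-injective (proj₁ nim)
                                      (sym (seed-at x x<L) ⟨ trans ⟩ e ⟨ trans ⟩ seed-at x' x'<L)) ⟩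
      toℕ (fromℕ< x'<L)          ≡⟨ toℕ-fromℕ< x'<L ⟩
      x'                         ∎

  G-injective : Injective _≡_ _≡_ G
  G-injective {x} {x'} e with <-cmp x x'
  ... | tri< x<x' _ _ = ⊥-elim (G-distinct x<x' e)
  ... | tri≈ _ x≡x' _ = x≡x'
  ... | tri> _ _ x'<x = ⊥-elim (G-distinct x'<x (sym e))

  attained-below : ∀ v → ∃[ B ] (∀ {u} → u < v → ∃[ z ] (z < B × G z ≡ u))
  attained-below zero = 0 , λ ()
  attained-below (suc v) with attained-below v
  ... | B , attained with eventually-∉ 1≤p perY (L + B) v
  ...   | y , L+B≤y , v∉Yy = suc y , attained′
    where
    B≤y = ≤-trans (m≤n+m B L) L+B≤y
    L≤y = ≤-trans (m≤m+n L B) L+B≤y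
    v-attained : ∃[ z ] (z ≤ y × G z ≡ v)
    v-attained with anyUpTo? (λ z → G z ≟ v) y
    ... | yes (z , z<y , e) = z , <⇒≤ z<y , e
    ... | no none = y , ≤-refl , ≤-antisym (mex-≤ {X = Excluded y} (mex-G L≤y) v∉Excluded)
                                           (≤-mex {X = Excluded y} (mex-G L≤y) below-v)
      where
      v∉Excluded : ¬ Excluded y (+ v)
      v∉Excluded (inj₁ (z , z<y , e)) = none (z , z<y , sym (ℤ.+-injective e))
      v∉Excluded (inj₂ v∈Yy) = v∉Yy v∈Yy
      below-v : ∀ k → k < v → Excluded y (+ k)
      below-v k k<v with attained k<v
      ... | z , z<B , refl = inj₁ (z , <-≤-trans z<B B≤y , refl)
    attained′ : ∀ {u} → u < suc v → ∃[ z ] (z < suc y × G z ≡ u)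
    attained′ u<1+v with m<1+n⇒m<n∨m≡n u<1+v
    ... | inj₁ u<v = Product.map₂ (Product.map₁ (λ z<B → m<n⇒m<1+n (<-≤-trans z<B B≤y))) (attained u<v)
    ... | inj₂ refl = Product.map₂ (Product.map₁ s≤s) v-attained

  G-surjective : ∀ v → ∃[ z ] (G z ≡ v)
  G-surjective v = Product.map₂ proj₂ (proj₂ (attained-below (suc v)) (n<1+n v))

  module _ {N x₀ : ℕ} (perY-N : IsPeriodOfY Y N) (L≤x₀ : L ≤ x₀)
           (S*≐ : ShiftEq (SStar G (x₀ + N)) (SStar G x₀) N)
           (T*≐ : ShiftEq (TStar G (x₀ + N)) (TStar G x₀) N) where

    Invariant : ℕ → Set
    Invariant y = PaddedShift (Values G (y + N)) (Values G y) N

    invariant⇒shift : ∀ {y} → L ≤ y → Invariant y → G (y + N) ≡ G y + N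
    invariant⇒shift {y} L≤y inv =
      mex-shift {X = Excluded y} {Excluded (y + N)} (mex-G L≤y) (mex-G (≤-trans L≤y (m≤m+n y N)))
        (paddedShift-≐ (excluded≐ (y + N)) (excluded≐ y) (paddedShift-∪ inv (shiftAbove-ℕ∈ perY-N y)))

    invariant-suc : ∀ {y} → L ≤ y → Invariant y → Invariant (suc y)
    invariant-suc {y} L≤y inv =
      paddedShift-≐ (values-suc G (y + N)) (values-suc G y)
        (paddedShift-∪ inv (subst (λ c → ShiftAbove ｛ c ｝ ｛ G y ｝ N)
                                  (sym (invariant⇒shift L≤y inv)) shiftAbove-｛｝))

    invariant-base : Invariant (suc x₀)
    invariant-base =
      paddedShift-≐ (cut≐values G-injective G-surjective (x₀ + N))
                    (cut≐values G-injective G-surjective x₀)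
                    (paddedShift-cut x₀ N S*≐ T*≐)

    invariant : ∀ {y} → suc x₀ ≤′ y → Invariant y
    invariant ≤′-refl = invariant-base
    invariant (≤′-step x₀<′y) =
      invariant-suc (≤-trans L≤x₀ (<⇒≤ (≤′⇒≤ x₀<′y))) (invariant x₀<′y)

    periodFrom-N : PeriodFrom G (suc x₀) N
    periodFrom-N y x₀<y = invariant⇒shift (≤-trans L≤x₀ (<⇒≤ x₀<y)) (invariant (≤⇒≤′ x₀<y))

lemmal : (Y : ℕ → List ℤ) (p : ℕ) → YPeriodLength Y p →
    (seed : List ℕ) (G : ℕ → ℕ) → IsNimSequence Y seed G →
    (R : ℕ) → 1 ≤ R →
    (∃[ q ] (GPeriodLength G q × q ∣ R * p))
    ⇔ (∃[ x ] (x ≥ length seed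
    × ShiftEq (SStar G (x + R * p)) (SStar G x) (R * p)
    × ShiftEq (TStar G (x + R * p)) (TStar G x) (R * p)))
lemmal Y p (1≤p , perY , _) seed G nim R 1≤R = mk⇔ periodic⇒cutsRepeat cutsRepeat⇒periodic
  where
  periodic⇒cutsRepeat : ∃[ q ] (GPeriodLength G q × q ∣ R * p) →
                        ∃[ x ] (x ≥ length seed × CutsRepeat G x (R * p))
  periodic⇒cutsRepeat (q , (_ , (P , per-q) , _) , divides k Rp≡kq) =
    cutsRepeat-eventually G (subst (PeriodFrom G P) (sym Rp≡kq) (periodFrom-* G per-q k)) (length seed)
  cutsRepeat⇒periodic : ∃[ x ] (x ≥ length seed × CutsRepeat G x (R * p)) →
                        ∃[ q ] (GPeriodLength G q × q ∣ R * p)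
  cutsRepeat⇒periodic (x₀ , L≤x₀ , S*≐ , T*≐) =
    leastPeriod G (*-mono-≤ 1≤R 1≤p)
      (NimSequence.periodFrom-N 1≤p perY nim (isPeriodOfY-* perY R) L≤x₀ S*≐ T*≐)
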